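{- There is a function $C_3(t,\epsilon)$ such that the following holds for all $t\in\mathbb{N}$ and $0<\epsilon<1$: let $G$ be a bipartite graph with minimum degree $\delta(G)\geq C_3(t,\epsilon)$ which is induced $S_{t,t}$-free. Then for every path $x_1x_2x_3x_4$ of length $3$ in $G$ we have $|S_{N(x_1)}^{N(x_4)}(\epsilon)|\leq C_3(t,\epsilon)$.
   Context: $S_{t,t}$ is the graph with vertex set $\{x,x_1,\dots,x_t,y,y_1,\dots,y_t\}$ and edge set $\{xy\}\cup\{xy_1,\dots,xy_t\}\cup\{yx_1,\dots,yx_t\}$; induced $S_{t,t}$-free means no induced subgraph isomorphic to $S_{t,t}$. $N(v)$ is the neighbourhood of $v$. For vertex sets $X,Y$ and $\varepsilon\in(0,1)$, $S_X^Y(\varepsilon)=\{x\in X : |N(x)\cap Y|\leq (1-\varepsilon)|Y|\}$.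
   Formalization: The parameter ε ranges over the rationals in the interval (0,1), so the function $C_3(t,\epsilon)$ is defined only for rational ε. -}

module Defs where

open import Data.Nat using (ℕ; _≤_)
open import Data.Bool using (Bool; true; false; _∧_)
open import Data.Fin using (Fin)
open import Data.Fin.Subset using (Subset; _∩_; ∣_∣)
open import Data.Vec using (tabulate; lookup)
open import Data.Integer using (+_)
open import Data.Rational using (ℚ; 1ℚ; _-_; _*_; _/_)
import Data.Rational as Q
open import Data.Rational.Properties using (_≤?_)
open import Relation.Nullary.Decidable using (⌊_⌋)
open import Relation.Nullary using (¬_)
open import Relation.Binary.PropositionalEquality using (_≡_; _≢_)
open import Data.Product using (Σ; _×_)
open import Function.Definitions using (Injective)

record Graph : Set where
  field
    n     : ℕ
    adj   : Fin n → Fin n → Bool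
    sym   : ∀ u v → adj u v ≡ adj v u
    irrefl : ∀ v → adj v v ≡ false

open Graph public

Edge : (G : Graph) → Fin (n G) → Fin (n G) → Set
Edge G u v = adj G u v ≡ true

N : (G : Graph) → Fin (n G) → Subset (n G)
N G v = tabulate (adj G v)

degree : (G : Graph) → Fin (n G) → ℕ
degree G v = ∣ N G v ∣

MinDegree≥ : Graph → ℕ → Set
MinDegree≥ G d = ∀ v → d ≤ degree G v

Bipartite : Graph → Set
Bipartite G = Σ (Fin (n G) → Bool) λ c → ∀ u v → Edge G u v → c u ≢ c v

data SV (t : ℕ) : Set where
  vx vy : SV t
  vxi vyi : Fin t → SV t

sadj : ∀ {t} → SV t → SV t → Bool
sadj vx vy = true
sadj vy vx = true
sadj vx (vyi _) = true
sadj (vyi _) vx = true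
sadj vy (vxi _) = true
sadj (vxi _) vy = true
sadj _ _ = false

HasInducedS : ℕ → Graph → Set
HasInducedS t G = Σ (SV t → Fin (n G)) λ φ →
  Injective _≡_ _≡_ φ × (∀ a b → adj G (φ a) (φ b) ≡ sadj a b)

InducedSttFree : ℕ → Graph → Set
InducedSttFree t G = ¬ HasInducedS t G

toℚ : ℕ → ℚ
toℚ k = + k / 1

S : (G : Graph) → Subset (n G) → Subset (n G) → ℚ → Subset (n G)
S G X Y ε = tabulate λ x →
  lookup X x ∧ ⌊ toℚ ∣ N G x ∩ Y ∣ ≤? ((1ℚ - ε) * toℚ ∣ Y ∣) ⌋

Path4 : (G : Graph) → (a b c d : Fin (n G)) → Set
Path4 G a b c d =
  Edge G a b × Edge G b c × Edge G c d ×
  a ≢ b × a ≢ c × a ≢ d × b ≢ c × b ≢ d × c ≢ d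

{-# OPTIONS --safe #-}
-- Let D be the denominator of ε, so that every vertex of S = S_{N(x₁)}^{N(x₄)}(ε) misses at
-- least a 1/D fraction of N(x₄).  The engine is a greedy lemma: if xy is an edge and Z ⊆ N(y)
-- has at least 2pt vertices, then fewer than t(2p)^t neighbours of x miss a 1/p fraction of Z.
-- Otherwise pick vertices of Z one at a time, each time keeping the (by double counting, at
-- least 1/2p) fraction of the remaining neighbours of x that miss it; after t rounds this
-- leaves t vertices of Z and t neighbours of x with no edges between them, which together
-- with x and y span an induced S_{t,t} because G is bipartite.
-- Applied at x₃, the greedy lemma yields a neighbour r of x₃ missing little of N(x₄) and of
-- N(x₂); applied at x₁, almost all of S misses little of N(x₂), so some w ∈ N(x₂) ∩ N(r) is
-- adjacent to half of them.  Those vertices miss a 1/2D fraction of N(x₄) ∩ N(r) ⊆ N(r) and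
-- wr is an edge, so a last application of the greedy lemma bounds their number, hence |S|.
module Submission where

open import Data.Bool.Base using (Bool; true; false; not; _∧_)
open import Data.Bool.Properties using (¬-not; ∧-zeroʳ; ∧-identityʳ)
open import Data.Fin.Base using (Fin; zero; suc)
import Data.Fin.Properties as Fin
open import Data.Fin.Subset
  using (Subset; inside; outside; _∈_; _∉_; _⊆_; _∩_; _∪_; _─_; ⁅_⁆; ⊥; ∣_∣; Nonempty)
open import Data.Fin.Subset.Properties
  using ( _∈?_; nonempty?; Empty-unique; ∉⊥; ∣⊥∣≡0; p⊆q⇒∣p∣≤∣q∣; p∩q⊆q; ∣p∩q∣≤∣p∣; ∩-comm
        ; x∈p∩q⁺; x∈p∩q⁻; ∪-identityʳ; x∈p∪q⁻; x∈⁅y⁆⇒x≡y; p─q⊆p; x∈p∧x∉q⇒x∈p─q; ∣p─q∣≤∣p∣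
        ; p─q─r≡p─r─q )
import Data.Integer.Base as ℤ
import Data.Integer.Properties as ℤ
import Data.Integer.Tactic.RingSolver as ℤ-Solver
open import Data.Nat.Base using (ℕ; zero; suc; _+_; _*_; _^_; _≤_; _<_; NonZero; z≤n; s≤s; z<s)
open import Data.Nat.Properties
open import Data.Nat.Tactic.RingSolver using (solve-∀)
open import Data.Product using (Σ; ∃; _×_; _,_; proj₁; proj₂)
open import Data.Rational.Base as ℚ using (ℚ; mkℚ; 0ℚ; 1ℚ; ↧ₙ_; *<*)
open import Data.Rational.Properties as ℚ
  using (toℚᵘ-mono-≤; toℚᵘ-homo-*; toℚᵘ-homo-+; toℚᵘ-homo‿-; toℚᵘ-fromℚᵘ)
import Data.Rational.Unnormalised.Base as ℚᵘ
import Data.Rational.Unnormalised.Properties as ℚᵘ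
open import Data.Sum using (inj₁; inj₂)
open import Data.Vec.Base using (tabulate; lookup; _∷_; []; here; there)
open import Data.Vec.Properties using (lookup∘tabulate; []=⇒lookup; lookup⇒[]=)
open import Function.Base using (_∘_; id)
open import Function.Definitions using (Injective)
open import Relation.Binary.PropositionalEquality
  using (_≡_; _≢_; refl; sym; trans; cong; cong₂; subst; subst₂; module ≡-Reasoning)
open import Relation.Nullary.Decidable
  using (yes; ⌊_⌋; _×-dec_; decidable-stable; isYes≗does; dec-true)
open import Relation.Nullary.Negation using (contradiction)
open import Relation.Unary using (Pred; Decidable)
open import Algebra.Properties.CommutativeSemigroup *-commutativeSemigroup using (x∙yz≈y∙xz)
open import Algebra.Properties.Semiring.Sum +-*-semiring
  using (sum; ∑-comm; *-distribˡ-sum; sum-cong-≗)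

open import Defs hiding (sym)

m<m+n⇒0<n : ∀ m {n} → m < m + n → 0 < n
m<m+n⇒0<n m {zero}  m<m+0 = contradiction (subst (m <_) (+-identityʳ m) m<m+0) (<-irrefl refl)
m<m+n⇒0<n m {suc n} _     = z<s

x≤a+b⇒2a≤x⇒x≤2b : ∀ {x} a b → x ≤ a + b → 2 * a ≤ x → x ≤ 2 * b
x≤a+b⇒2a≤x⇒x≤2b {x} a b x≤a+b 2a≤x = +-cancelˡ-≤ x x (2 * b) (begin
  x + x             ≡⟨ cong (x +_) (+-identityʳ x) ⟨
  2 * x             ≤⟨ *-monoʳ-≤ 2 x≤a+b ⟩
  2 * (a + b)       ≡⟨ *-distribˡ-+ 2 a b ⟩
  2 * a + 2 * b     ≤⟨ +-monoˡ-≤ (2 * b) 2a≤x ⟩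
  x + 2 * b         ∎)
  where open ≤-Reasoning

-- The point is ε ≥ 1/↧ε.  The hypothesis is cross-multiplied in ℚᵘ, where (1 - ε) * toℚ (k + j)
-- computes without gcd normalisation.
missing-fraction : ∀ ε → 0ℚ ℚ.< ε → ∀ k j → toℚ k ℚ.≤ (1ℚ ℚ.- ε) ℚ.* toℚ (k + j) → k + j ≤ ↧ₙ ε * j
missing-fraction (mkℚ (ℤ.+ 0)      _ _) (*<* (ℤ.+<+ ()))
missing-fraction (mkℚ ℤ.-[1+ _ ]   _ _) (*<* ())
missing-fraction ε@(mkℚ ℤ.+[1+ a ] d _) _ k j k≤ = begin
  k + j              ≤⟨ m≤n*m (k + j) (suc a) ⟩
  suc a * (k + j)    ≤⟨ +-cancelˡ-≤ (suc d * k) _ _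
                          (≤-trans cross-multiplied (≤-reflexive (*-distribˡ-+ (suc d) k j))) ⟩
  suc d * j          ∎
  where
  open ≤-Reasoning
  m : ℕ
  m = k + j
  in-ℚᵘ : ℚᵘ.mkℚᵘ (ℤ.+ k) 0 ℚᵘ.≤ (ℚᵘ.1ℚᵘ ℚᵘ.- ℚᵘ.mkℚᵘ ℤ.+[1+ a ] d) ℚᵘ.* ℚᵘ.mkℚᵘ (ℤ.+ m) 0
  in-ℚᵘ = ℚᵘ.≤-respʳ-≃ (ℚᵘ.≃-trans (toℚᵘ-homo-* (1ℚ ℚ.- ε) (toℚ m))
                          (ℚᵘ.*-cong (ℚᵘ.≃-trans (toℚᵘ-homo-+ 1ℚ (ℚ.- ε)) (ℚᵘ.+-congʳ ℚᵘ.1ℚᵘ (toℚᵘ-homo‿- ε)))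
                                     (toℚᵘ-fromℚᵘ (ℚᵘ.mkℚᵘ (ℤ.+ m) 0))))
          (ℚᵘ.≤-respˡ-≃ (toℚᵘ-fromℚᵘ (ℚᵘ.mkℚᵘ (ℤ.+ k) 0)) (toℚᵘ-mono-≤ k≤))
  cross-multiplied : suc d * k + suc a * m ≤ suc d * m
  cross-multiplied with in-ℚᵘ
  ... | ℚᵘ.*≤* k≤[1-ε]m = ℤ.drop‿+≤+ (subst₂ ℤ._≤_ lhs rhs (ℤ.+-monoˡ-≤ (ℤ.+[1+ a ] ℤ.* ℤ.+ m) k≤[1-ε]m))
    where
    lhs : ℤ.+ k ℤ.* ((ℤ.+ 1 ℤ.* ℤ.+ suc d) ℤ.* ℤ.+ 1) ℤ.+ ℤ.+[1+ a ] ℤ.* ℤ.+ m ≡ ℤ.+ (suc d * k + suc a * m)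
    lhs = trans (normal (ℤ.+ k) (ℤ.+ suc d) ℤ.+[1+ a ] (ℤ.+ m))
                (sym (trans (ℤ.pos-+ (suc d * k) (suc a * m))
                            (cong₂ ℤ._+_ (ℤ.pos-* (suc d) k) (ℤ.pos-* (suc a) m))))
      where
      normal : ∀ K D A M → K ℤ.* ((ℤ.+ 1 ℤ.* D) ℤ.* ℤ.+ 1) ℤ.+ A ℤ.* M ≡ D ℤ.* K ℤ.+ A ℤ.* M
      normal = ℤ-Solver.solve-∀
    rhs : ((ℤ.+ 1 ℤ.* ℤ.+ suc d ℤ.+ ℤ.- ℤ.+[1+ a ] ℤ.* ℤ.+ 1) ℤ.* ℤ.+ m) ℤ.* ℤ.+ 1 ℤ.+ ℤ.+[1+ a ] ℤ.* ℤ.+ m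
          ≡ ℤ.+ (suc d * m)
    rhs = trans (normal (ℤ.+ suc d) ℤ.+[1+ a ] (ℤ.+ m)) (sym (ℤ.pos-* (suc d) m))
      where
      normal : ∀ D A M → ((ℤ.+ 1 ℤ.* D ℤ.+ ℤ.- A ℤ.* ℤ.+ 1) ℤ.* M) ℤ.* ℤ.+ 1 ℤ.+ A ℤ.* M ≡ D ℤ.* M
      normal = ℤ-Solver.solve-∀

∈-tabulate⁺ : ∀ {m} (f : Fin m → Bool) {x} → f x ≡ true → x ∈ tabulate f
∈-tabulate⁺ f {x} fx = lookup⇒[]= x (tabulate f) (trans (lookup∘tabulate f x) fx)

∈-tabulate⁻ : ∀ {m} (f : Fin m → Bool) {x} → x ∈ tabulate f → f x ≡ true
∈-tabulate⁻ f {x} x∈ = trans (sym (lookup∘tabulate f x)) ([]=⇒lookup x∈)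

x∈p─q⇒x∉q : ∀ {m} {p q : Subset m} {x} → x ∈ p ─ q → x ∉ q
x∈p─q⇒x∉q {p = _ ∷ _} {outside ∷ _} here       ()
x∈p─q⇒x∉q {p = _ ∷ _} {_       ∷ _} (there x∈) (there x∈q) = x∈p─q⇒x∉q x∈ x∈q

p∩q─r⊆p─r : ∀ {m} (p q r : Subset m) → p ∩ q ─ r ⊆ p ─ r
p∩q─r⊆p─r p q r x∈ = x∈p∧x∉q⇒x∈p─q (proj₁ (x∈p∩q⁻ p q (p─q⊆p _ r x∈))) (x∈p─q⇒x∉q x∈)

p∩tabulate-not≡p─tabulate : ∀ {m} (p : Subset m) (f : Fin m → Bool) → p ∩ tabulate (not ∘ f) ≡ p ─ tabulate f
p∩tabulate-not≡p─tabulate []      f = refl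
p∩tabulate-not≡p─tabulate (s ∷ p) f with f zero
... | true  = cong₂ _∷_ (∧-zeroʳ s)     (p∩tabulate-not≡p─tabulate p (f ∘ suc))
... | false = cong₂ _∷_ (∧-identityʳ s) (p∩tabulate-not≡p─tabulate p (f ∘ suc))

∣p∣≡∣p∩q∣+∣p─q∣ : ∀ {m} (p q : Subset m) → ∣ p ∣ ≡ ∣ p ∩ q ∣ + ∣ p ─ q ∣
∣p∣≡∣p∩q∣+∣p─q∣ []            []            = refl
∣p∣≡∣p∩q∣+∣p─q∣ (inside  ∷ p) (inside  ∷ q) = cong suc (∣p∣≡∣p∩q∣+∣p─q∣ p q)
∣p∣≡∣p∩q∣+∣p─q∣ (inside  ∷ p) (outside ∷ q) = trans (cong suc (∣p∣≡∣p∩q∣+∣p─q∣ p q)) (sym (+-suc _ _))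
∣p∣≡∣p∩q∣+∣p─q∣ (outside ∷ p) (inside  ∷ q) = ∣p∣≡∣p∩q∣+∣p─q∣ p q
∣p∣≡∣p∩q∣+∣p─q∣ (outside ∷ p) (outside ∷ q) = ∣p∣≡∣p∩q∣+∣p─q∣ p q

∣p∣≤∣q∣+∣p─q∣ : ∀ {m} (p q : Subset m) → ∣ p ∣ ≤ ∣ q ∣ + ∣ p ─ q ∣
∣p∣≤∣q∣+∣p─q∣ p q =
  ≤-trans (≤-reflexive (∣p∣≡∣p∩q∣+∣p─q∣ p q)) (+-monoˡ-≤ ∣ p ─ q ∣ (p⊆q⇒∣p∣≤∣q∣ (p∩q⊆q p q)))

∣p─r∣≤∣p─q∣+∣p∩q─r∣ : ∀ {m} (p q r : Subset m) → ∣ p ─ r ∣ ≤ ∣ p ─ q ∣ + ∣ p ∩ q ─ r ∣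
∣p─r∣≤∣p─q∣+∣p∩q─r∣ p q r = begin
  ∣ p ─ r ∣                        ≡⟨ ∣p∣≡∣p∩q∣+∣p─q∣ (p ─ r) q ⟩
  ∣ (p ─ r) ∩ q ∣ + ∣ p ─ r ─ q ∣  ≡⟨ +-comm (∣ (p ─ r) ∩ q ∣) (∣ p ─ r ─ q ∣) ⟩
  ∣ p ─ r ─ q ∣ + ∣ (p ─ r) ∩ q ∣  ≤⟨ +-mono-≤ (p⊆q⇒∣p∣≤∣q∣ p─r─q⊆p─q) (p⊆q⇒∣p∣≤∣q∣ p─r∩q⊆p∩q─r) ⟩
  ∣ p ─ q ∣ + ∣ p ∩ q ─ r ∣        ∎
  where
  open ≤-Reasoning
  p─r─q⊆p─q : p ─ r ─ q ⊆ p ─ q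
  p─r─q⊆p─q x∈ = p─q⊆p _ r (subst (_ ∈_) (p─q─r≡p─r─q p r q) x∈)
  p─r∩q⊆p∩q─r : (p ─ r) ∩ q ⊆ p ∩ q ─ r
  p─r∩q⊆p∩q─r x∈ with x∈p∩q⁻ (p ─ r) q x∈
  ... | x∈p─r , x∈q = x∈p∧x∉q⇒x∈p─q (x∈p∩q⁺ (p─q⊆p p r x∈p─r , x∈q)) (x∈p─q⇒x∉q x∈p─r)

x∉p⇒∣p∪⁅x⁆∣≡1+∣p∣ : ∀ {m} {p : Subset m} {x} → x ∉ p → ∣ p ∪ ⁅ x ⁆ ∣ ≡ suc ∣ p ∣
x∉p⇒∣p∪⁅x⁆∣≡1+∣p∣ {p = outside ∷ p} {zero}  _   = cong (suc ∘ ∣_∣) (∪-identityʳ p)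
x∉p⇒∣p∪⁅x⁆∣≡1+∣p∣ {p = inside  ∷ p} {zero}  x∉p = contradiction here x∉p
x∉p⇒∣p∪⁅x⁆∣≡1+∣p∣ {p = outside ∷ p} {suc x} x∉p = x∉p⇒∣p∪⁅x⁆∣≡1+∣p∣ (x∉p ∘ there)
x∉p⇒∣p∪⁅x⁆∣≡1+∣p∣ {p = inside  ∷ p} {suc x} x∉p = cong suc (x∉p⇒∣p∪⁅x⁆∣≡1+∣p∣ (x∉p ∘ there))

0<∣p∣⇒Nonempty : ∀ {m} (p : Subset m) → 0 < ∣ p ∣ → Nonempty p
0<∣p∣⇒Nonempty {m} p 0<∣p∣ = decidable-stable (nonempty? p)
  λ empty → <⇒≢ 0<∣p∣ (sym (trans (cong ∣_∣ (Empty-unique empty)) (∣⊥∣≡0 m)))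

∣p─q∣<∣p∣⇒Nonempty[p∩q] : ∀ {m} (p q : Subset m) → ∣ p ─ q ∣ < ∣ p ∣ → Nonempty (p ∩ q)
∣p─q∣<∣p∣⇒Nonempty[p∩q] p q ∣p─q∣<∣p∣ = 0<∣p∣⇒Nonempty (p ∩ q)
  (+-cancelʳ-< (∣ p ─ q ∣) 0 (∣ p ∩ q ∣) (<-≤-trans ∣p─q∣<∣p∣ (≤-reflexive (∣p∣≡∣p∩q∣+∣p─q∣ p q))))

∣q∣<∣p∣⇒Nonempty[p─q] : ∀ {m} (p q : Subset m) → ∣ q ∣ < ∣ p ∣ → Nonempty (p ─ q)
∣q∣<∣p∣⇒Nonempty[p─q] p q ∣q∣<∣p∣ =
  0<∣p∣⇒Nonempty (p ─ q) (m<m+n⇒0<n ∣ q ∣ (<-≤-trans ∣q∣<∣p∣ (∣p∣≤∣q∣+∣p─q∣ p q)))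

∣q∣+∣r∣<∣p∣⇒Nonempty[p─q─r] : ∀ {m} (p q r : Subset m) → ∣ q ∣ + ∣ r ∣ < ∣ p ∣ → Nonempty (p ─ q ─ r)
∣q∣+∣r∣<∣p∣⇒Nonempty[p─q─r] p q r ∣q∣+∣r∣<∣p∣ = ∣q∣<∣p∣⇒Nonempty[p─q] (p ─ q) r
  (+-cancelˡ-< (∣ q ∣) (∣ r ∣) (∣ p ─ q ∣) (<-≤-trans ∣q∣+∣r∣<∣p∣ (∣p∣≤∣q∣+∣p─q∣ p q)))

∣p∣≤2∣p∩q∣ : ∀ {m} (p q : Subset m) → 2 * ∣ p ─ q ∣ ≤ ∣ p ∣ → ∣ p ∣ ≤ 2 * ∣ p ∩ q ∣
∣p∣≤2∣p∩q∣ p q 2∣p─q∣≤∣p∣ = x≤a+b⇒2a≤x⇒x≤2b (∣ p ─ q ∣) (∣ p ∩ q ∣)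
  (≤-reflexive (trans (∣p∣≡∣p∩q∣+∣p─q∣ p q) (+-comm (∣ p ∩ q ∣) (∣ p ─ q ∣)))) 2∣p─q∣≤∣p∣

∣p∩q∣≤2∣p∩q∩r∣ : ∀ {m} (p q r : Subset m) → 4 * ∣ p ─ q ∣ ≤ ∣ p ∣ → 4 * ∣ p ─ r ∣ ≤ ∣ p ∣ →
                 ∣ p ∩ q ∣ ≤ 2 * ∣ (p ∩ q) ∩ r ∣
∣p∩q∣≤2∣p∩q∩r∣ p q r 4∣p─q∣≤∣p∣ 4∣p─r∣≤∣p∣ = begin
  ∣ p ∩ q ∣           ≤⟨ ∣p∩q∣≤∣p∣ p q ⟩
  ∣ p ∣               ≤⟨ x≤a+b⇒2a≤x⇒x≤2b (∣ p ─ q ∣ + ∣ p ─ r ∣) _ covered (*-cancelˡ-≤ 2 halves) ⟩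
  2 * ∣ (p ∩ q) ∩ r ∣ ∎
  where
  open ≤-Reasoning
  covered : ∣ p ∣ ≤ ∣ p ─ q ∣ + ∣ p ─ r ∣ + ∣ (p ∩ q) ∩ r ∣
  covered = begin
    ∣ p ∣                                         ≡⟨ ∣p∣≡∣p∩q∣+∣p─q∣ p q ⟩
    ∣ p ∩ q ∣ + ∣ p ─ q ∣                         ≡⟨ cong (_+ ∣ p ─ q ∣) (∣p∣≡∣p∩q∣+∣p─q∣ (p ∩ q) r) ⟩
    ∣ (p ∩ q) ∩ r ∣ + ∣ p ∩ q ─ r ∣ + ∣ p ─ q ∣
      ≤⟨ +-monoˡ-≤ ∣ p ─ q ∣ (+-monoʳ-≤ ∣ (p ∩ q) ∩ r ∣ (p⊆q⇒∣p∣≤∣q∣ (p∩q─r⊆p─r p q r))) ⟩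
    ∣ (p ∩ q) ∩ r ∣ + ∣ p ─ r ∣ + ∣ p ─ q ∣       ≡⟨ reverse (∣ (p ∩ q) ∩ r ∣) (∣ p ─ r ∣) (∣ p ─ q ∣) ⟩
    ∣ p ─ q ∣ + ∣ p ─ r ∣ + ∣ (p ∩ q) ∩ r ∣       ∎
    where
    reverse : ∀ x y z → x + y + z ≡ z + y + x
    reverse = solve-∀
  halves : 2 * (2 * (∣ p ─ q ∣ + ∣ p ─ r ∣)) ≤ 2 * ∣ p ∣
  halves = begin
    2 * (2 * (∣ p ─ q ∣ + ∣ p ─ r ∣)) ≡⟨ distrib (∣ p ─ q ∣) (∣ p ─ r ∣) ⟩
    4 * ∣ p ─ q ∣ + 4 * ∣ p ─ r ∣     ≤⟨ +-mono-≤ 4∣p─q∣≤∣p∣ 4∣p─r∣≤∣p∣ ⟩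
    ∣ p ∣ + ∣ p ∣                      ≡⟨ cong (∣ p ∣ +_) (+-identityʳ ∣ p ∣) ⟨
    2 * ∣ p ∣                          ∎
    where
    distrib : ∀ a b → 2 * (2 * (a + b)) ≡ 4 * a + 4 * b
    distrib = solve-∀

∣p∩q∣≤2k∣p∩q─r∣ : ∀ {m} k (p q r : Subset m) → 2 * k * ∣ p ─ q ∣ ≤ ∣ p ∣ → ∣ p ∣ ≤ k * ∣ p ─ r ∣ →
                  ∣ p ∩ q ∣ ≤ 2 * k * ∣ p ∩ q ─ r ∣
∣p∩q∣≤2k∣p∩q─r∣ k p q r 2k∣p─q∣≤∣p∣ ∣p∣≤k∣p─r∣ = begin
  ∣ p ∩ q ∣                ≤⟨ ∣p∩q∣≤∣p∣ p q ⟩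
  ∣ p ∣                    ≤⟨ x≤a+b⇒2a≤x⇒x≤2b (k * ∣ p ─ q ∣) _ covered
                                (≤-trans (≤-reflexive (sym (*-assoc 2 k _))) 2k∣p─q∣≤∣p∣) ⟩
  2 * (k * ∣ p ∩ q ─ r ∣)  ≡⟨ *-assoc 2 k _ ⟨
  2 * k * ∣ p ∩ q ─ r ∣    ∎
  where
  open ≤-Reasoning
  covered : ∣ p ∣ ≤ k * ∣ p ─ q ∣ + k * ∣ p ∩ q ─ r ∣
  covered = begin
    ∣ p ∣                               ≤⟨ ∣p∣≤k∣p─r∣ ⟩
    k * ∣ p ─ r ∣                       ≤⟨ *-monoʳ-≤ k (∣p─r∣≤∣p─q∣+∣p∩q─r∣ p q r) ⟩
    k * (∣ p ─ q ∣ + ∣ p ∩ q ─ r ∣)     ≡⟨ *-distribˡ-+ k _ _ ⟩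
    k * ∣ p ─ q ∣ + k * ∣ p ∩ q ─ r ∣   ∎

filter : ∀ {m ℓ} {P : Pred (Fin m) ℓ} → Decidable P → Subset m → Subset m
filter P? p = tabulate (λ x → lookup p x ∧ ⌊ P? x ⌋)

module _ {m ℓ} {P : Pred (Fin m) ℓ} (P? : Decidable P) {p : Subset m} {x : Fin m} where

  ∈-filter⁺ : x ∈ p → P x → x ∈ filter P? p
  ∈-filter⁺ x∈p Px =
    ∈-tabulate⁺ _ (cong₂ _∧_ ([]=⇒lookup x∈p) (trans (isYes≗does (P? x)) (dec-true (P? x) Px)))

  ∈-filter⁻ : x ∈ filter P? p → x ∈ p × P x
  ∈-filter⁻ x∈ with lookup p x in px≡true | P? x | ∈-tabulate⁻ _ x∈
  ... | true | yes Px | _ = lookup⇒[]= x p px≡true , Px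

injection-into : ∀ {m t} (p : Subset m) → t ≤ ∣ p ∣ →
                 Σ (Fin t → Fin m) λ φ → Injective _≡_ _≡_ φ × (∀ i → φ i ∈ p)
injection-into {t = zero}  _             _ = (λ ()) , (λ { {()} }) , (λ ())
injection-into {t = suc t} (outside ∷ p) t<∣p∣ with injection-into p t<∣p∣
... | φ , φ-inj , φ∈p = suc ∘ φ , φ-inj ∘ Fin.suc-injective , there ∘ φ∈p
injection-into {suc m} {suc t} (inside  ∷ p) (s≤s t≤∣p∣) with injection-into p t≤∣p∣
... | φ , φ-inj , φ∈p = ψ , ψ-inj , ψ∈p
  where
  ψ : Fin (suc t) → Fin (suc m)
  ψ zero    = zero
  ψ (suc i) = suc (φ i)
  ψ-inj : Injective _≡_ _≡_ ψ
  ψ-inj {zero}  {zero}  _  = refl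
  ψ-inj {suc i} {suc j} eq = cong suc (φ-inj (Fin.suc-injective eq))
  ψ∈p : ∀ i → ψ i ∈ inside ∷ p
  ψ∈p zero    = here
  ψ∈p (suc i) = there (φ∈p i)

-- Double counting

indicator : Bool → ℕ
indicator true  = 1
indicator false = 0

∑∈ : ∀ {m} → Subset m → (Fin m → ℕ) → ℕ
∑∈ p f = sum (λ i → indicator (lookup p i) * f i)

syntax ∑∈ p (λ i → e) = ∑[ i ∈ p ] e

∑∈-const : ∀ {m} (p : Subset m) k → ∑[ i ∈ p ] k ≡ ∣ p ∣ * k
∑∈-const []            k = refl
∑∈-const (outside ∷ p) k = ∑∈-const p k
∑∈-const (inside  ∷ p) k = cong₂ _+_ (*-identityˡ k) (∑∈-const p k)

∑∈-mono-≤ : ∀ {m} {p : Subset m} {f g : Fin m → ℕ} → (∀ {i} → i ∈ p → f i ≤ g i) → ∑∈ p f ≤ ∑∈ p g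
∑∈-mono-≤ {p = []}          f≤g = ≤-refl
∑∈-mono-≤ {p = outside ∷ p} f≤g = ∑∈-mono-≤ {p = p} (f≤g ∘ there)
∑∈-mono-≤ {p = inside  ∷ p} f≤g = +-mono-≤ (*-monoʳ-≤ 1 (f≤g here)) (∑∈-mono-≤ {p = p} (f≤g ∘ there))

∑∈-mono-< : ∀ {m} {p : Subset m} {f g : Fin m → ℕ} → Nonempty p → (∀ {i} → i ∈ p → f i < g i) → ∑∈ p f < ∑∈ p g
∑∈-mono-< {p = inside  ∷ p} (zero , here) f<g =
  +-mono-<-≤ (*-monoʳ-< 1 (f<g here)) (∑∈-mono-≤ {p = p} (<⇒≤ ∘ f<g ∘ there))
∑∈-mono-< {p = outside ∷ p} (suc i , there i∈p) f<g = ∑∈-mono-< {p = p} (i , i∈p) (f<g ∘ there)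
∑∈-mono-< {p = inside  ∷ p} (suc i , there i∈p) f<g =
  +-mono-≤-< (*-monoʳ-≤ 1 (<⇒≤ (f<g here))) (∑∈-mono-< {p = p} (i , i∈p) (f<g ∘ there))

∑∈-cong : ∀ {m} (p : Subset m) {f g : Fin m → ℕ} → (∀ i → f i ≡ g i) → ∑∈ p f ≡ ∑∈ p g
∑∈-cong p f≗g = sum-cong-≗ (λ i → cong (indicator (lookup p i) *_) (f≗g i))

∑∈-* : ∀ {m} (p : Subset m) c (f : Fin m → ℕ) → ∑[ i ∈ p ] (c * f i) ≡ c * ∑∈ p f
∑∈-* {m} p c f = begin
  ∑[ i ∈ p ] (c * f i)                         ≡⟨ sum-cong-≗ (λ i → x∙yz≈y∙xz (indicator (lookup p i)) c (f i)) ⟩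
  sum (λ i → c * (indicator (lookup p i) * f i)) ≡⟨ *-distribˡ-sum {m} c _ ⟨
  c * ∑∈ p f                                   ∎
  where open ≡-Reasoning

∑∈-comm : ∀ {m} (U Z : Subset m) (g : Fin m → Fin m → ℕ) →
          ∑[ u ∈ U ] ∑[ z ∈ Z ] g u z ≡ ∑[ z ∈ Z ] ∑[ u ∈ U ] g u z
∑∈-comm {m} U Z g = begin
  ∑[ u ∈ U ] ∑[ z ∈ Z ] g u z                         ≡⟨ sum-cong-≗ (λ u → *-distribˡ-sum {m} (ind U u) _) ⟩
  sum (λ u → sum (λ z → ind U u * (ind Z z * g u z))) ≡⟨ ∑-comm {m} {m} _ ⟩
  sum (λ z → sum (λ u → ind U u * (ind Z z * g u z)))
    ≡⟨ sum-cong-≗ (λ z → sum-cong-≗ (λ u → x∙yz≈y∙xz (ind U u) (ind Z z) (g u z))) ⟩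
  sum (λ z → sum (λ u → ind Z z * (ind U u * g u z))) ≡⟨ sum-cong-≗ (λ z → *-distribˡ-sum {m} (ind Z z) _) ⟨
  ∑[ z ∈ Z ] ∑[ u ∈ U ] g u z                         ∎
  where
  open ≡-Reasoning
  ind : Subset m → Fin m → ℕ
  ind p i = indicator (lookup p i)

∣p∩tabulate∣≡∑∈ : ∀ {m} (p : Subset m) (f : Fin m → Bool) → ∣ p ∩ tabulate f ∣ ≡ ∑[ i ∈ p ] indicator (f i)
∣p∩tabulate∣≡∑∈ []            f = refl
∣p∩tabulate∣≡∑∈ (outside ∷ p) f = ∣p∩tabulate∣≡∑∈ p (f ∘ suc)
∣p∩tabulate∣≡∑∈ (inside  ∷ p) f with f zero
... | true  = cong suc (∣p∩tabulate∣≡∑∈ p (f ∘ suc))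
... | false = ∣p∩tabulate∣≡∑∈ p (f ∘ suc)

module _ {m} (R : Fin m → Fin m → Bool) (R-sym : ∀ u v → R u v ≡ R v u) where

  double-counting : ∀ (U Z : Subset m) → ∑[ u ∈ U ] ∣ Z ∩ tabulate (R u) ∣ ≡ ∑[ z ∈ Z ] ∣ U ∩ tabulate (R z) ∣
  double-counting U Z = begin
    ∑[ u ∈ U ] ∣ Z ∩ tabulate (R u) ∣       ≡⟨ ∑∈-cong U (λ u → ∣p∩tabulate∣≡∑∈ Z (R u)) ⟩
    ∑[ u ∈ U ] ∑[ z ∈ Z ] indicator (R u z) ≡⟨ ∑∈-comm U Z (λ u z → indicator (R u z)) ⟩
    ∑[ z ∈ Z ] ∑[ u ∈ U ] indicator (R u z) ≡⟨ ∑∈-cong Z (λ z → ∑∈-cong U (λ u → cong indicator (R-sym u z))) ⟩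
    ∑[ z ∈ Z ] ∑[ u ∈ U ] indicator (R z u) ≡⟨ ∑∈-cong Z (λ z → ∣p∩tabulate∣≡∑∈ U (R z)) ⟨
    ∑[ z ∈ Z ] ∣ U ∩ tabulate (R z) ∣       ∎
    where open ≡-Reasoning

  popular-element : ∀ c {U Z : Subset m} → Nonempty Z →
                    (∀ {u} → u ∈ U → ∣ Z ∣ ≤ c * ∣ Z ∩ tabulate (R u) ∣) →
                    ∃ λ z → z ∈ Z × ∣ U ∣ ≤ c * ∣ U ∩ tabulate (R z) ∣
  popular-element c {U} {Z} Z≢∅ dense =
    decidable-stable (Fin.any? λ z → z ∈? Z ×-dec ∣ U ∣ ≤? c * ∣ U ∩ tabulate (R z) ∣) λ none →
      <-irrefl refl (begin-strict
        ∣ Z ∣ * ∣ U ∣                            ≡⟨ *-comm ∣ Z ∣ ∣ U ∣ ⟩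
        ∣ U ∣ * ∣ Z ∣                            ≡⟨ ∑∈-const U ∣ Z ∣ ⟨
        ∑[ u ∈ U ] ∣ Z ∣                         ≤⟨ ∑∈-mono-≤ {p = U} dense ⟩
        ∑[ u ∈ U ] (c * ∣ Z ∩ tabulate (R u) ∣)  ≡⟨ ∑∈-* U c _ ⟩
        c * ∑[ u ∈ U ] ∣ Z ∩ tabulate (R u) ∣    ≡⟨ cong (c *_) (double-counting U Z) ⟩
        c * ∑[ z ∈ Z ] ∣ U ∩ tabulate (R z) ∣    ≡⟨ ∑∈-* Z c _ ⟨
        ∑[ z ∈ Z ] (c * ∣ U ∩ tabulate (R z) ∣)  <⟨ ∑∈-mono-< {p = Z} Z≢∅ (λ z∈Z → ≰⇒> λ ≤c → none (_ , z∈Z , ≤c)) ⟩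
        ∑[ z ∈ Z ] ∣ U ∣                         ≡⟨ ∑∈-const Z ∣ U ∣ ⟩
        ∣ Z ∣ * ∣ U ∣                            ∎)
    where open ≤-Reasoning

module _ (G : Graph) where

  Edge-sym : ∀ {u v} → Edge G u v → Edge G v u
  Edge-sym {u} {v} uv = trans (Graph.sym G v u) uv

  Edge⇒∈N : ∀ {u v} → Edge G u v → v ∈ N G u
  Edge⇒∈N {u} = ∈-tabulate⁺ (adj G u)

  ∈N⇒Edge : ∀ {u v} → v ∈ N G u → Edge G u v
  ∈N⇒Edge {u} = ∈-tabulate⁻ (adj G u)

  Anticomplete : Subset (n G) → Subset (n G) → Set
  Anticomplete Y X = ∀ {u v} → u ∈ Y → v ∈ X → adj G u v ≡ false

  popular-neighbour : ∀ c {U Z : Subset (n G)} → Nonempty Z →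
                      (∀ {u} → u ∈ U → ∣ Z ∣ ≤ c * ∣ Z ∩ N G u ∣) →
                      ∃ λ z → z ∈ Z × ∣ U ∣ ≤ c * ∣ U ∩ N G z ∣
  popular-neighbour = popular-element (adj G) (Graph.sym G)

  popular-non-neighbour : ∀ c {U Z : Subset (n G)} → Nonempty Z →
                          (∀ {u} → u ∈ U → ∣ Z ∣ ≤ c * ∣ Z ─ N G u ∣) →
                          ∃ λ z → z ∈ Z × ∣ U ∣ ≤ c * ∣ U ─ N G z ∣
  popular-non-neighbour c {U} {Z} Z≢∅ sparse
    with popular-element (λ u v → not (adj G u v)) (λ u v → cong not (Graph.sym G u v)) c Z≢∅
           (λ {u} u∈U → subst (λ W → ∣ Z ∣ ≤ c * ∣ W ∣)
                              (sym (p∩tabulate-not≡p─tabulate Z (adj G u))) (sparse u∈U))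
  ... | z , z∈Z , popular =
    z , z∈Z , subst (λ W → ∣ U ∣ ≤ c * ∣ W ∣) (p∩tabulate-not≡p─tabulate U (adj G z)) popular

  far : ℕ → Subset (n G) → Subset (n G) → Subset (n G)
  far p Z = filter (λ u → ∣ Z ∣ ≤? p * ∣ Z ─ N G u ∣)

  module _ (p : ℕ) (Z : Subset (n G)) {X : Subset (n G)} {u : Fin (n G)} where

    ∈-far⁺ : u ∈ X → ∣ Z ∣ ≤ p * ∣ Z ─ N G u ∣ → u ∈ far p Z X
    ∈-far⁺ = ∈-filter⁺ (λ v → ∣ Z ∣ ≤? p * ∣ Z ─ N G v ∣)

    ∈-far⁻ : u ∈ far p Z X → u ∈ X × ∣ Z ∣ ≤ p * ∣ Z ─ N G u ∣
    ∈-far⁻ = ∈-filter⁻ (λ v → ∣ Z ∣ ≤? p * ∣ Z ─ N G v ∣)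

    ∉-far : u ∈ X → u ∉ far p Z X → p * ∣ Z ─ N G u ∣ < ∣ Z ∣
    ∉-far u∈X u∉far = ≰⇒> (u∉far ∘ ∈-far⁺ u∈X)

  S⊆far : ∀ {ε} → 0ℚ ℚ.< ε → ∀ X Y → S G X Y ε ⊆ far (↧ₙ ε) Y X
  S⊆far {ε} 0<ε X Y {u} u∈S = ∈-far⁺ (↧ₙ ε) Y (proj₁ u∈X×few) (∣Y∣≤↧ε∣Y─Nu∣ (proj₂ u∈X×few))
    where
    u∈X×few : u ∈ X × toℚ ∣ N G u ∩ Y ∣ ℚ.≤ (1ℚ ℚ.- ε) ℚ.* toℚ ∣ Y ∣
    u∈X×few = ∈-filter⁻ (λ v → toℚ ∣ N G v ∩ Y ∣ ℚ.≤? (1ℚ ℚ.- ε) ℚ.* toℚ ∣ Y ∣) {p = X} u∈S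
    ∣Y∣≡ : ∣ Y ∣ ≡ ∣ N G u ∩ Y ∣ + ∣ Y ─ N G u ∣
    ∣Y∣≡ = trans (∣p∣≡∣p∩q∣+∣p─q∣ Y (N G u)) (cong (λ q → ∣ q ∣ + ∣ Y ─ N G u ∣) (∩-comm Y (N G u)))
    ∣Y∣≤↧ε∣Y─Nu∣ : toℚ ∣ N G u ∩ Y ∣ ℚ.≤ (1ℚ ℚ.- ε) ℚ.* toℚ ∣ Y ∣ → ∣ Y ∣ ≤ ↧ₙ ε * ∣ Y ─ N G u ∣
    ∣Y∣≤↧ε∣Y─Nu∣ few-common = subst (_≤ ↧ₙ ε * ∣ Y ─ N G u ∣) (sym ∣Y∣≡)
      (missing-fraction ε 0<ε ∣ N G u ∩ Y ∣ ∣ Y ─ N G u ∣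
        (subst (λ k → toℚ ∣ N G u ∩ Y ∣ ℚ.≤ (1ℚ ℚ.- ε) ℚ.* toℚ k) ∣Y∣≡ few-common))

module _ (G : Graph) (bip : Bipartite G) where

  common-neighbour⇒non-adjacent : ∀ {w u v} → Edge G w u → Edge G w v → adj G u v ≡ false
  common-neighbour⇒non-adjacent {w} {u} {v} wu wv with adj G u v in uv
  ... | false = refl
  ... | true  = contradiction (trans (¬-not (proper w u wu ∘ sym)) (sym (¬-not (proper w v wv ∘ sym))))
                              (proper u v uv)
    where
    proper : ∀ u v → Edge G u v → proj₁ bip u ≢ proj₁ bip v
    proper = proj₂ bip

  induced-Stt : ∀ {t x y} {φX φY : Fin t → Fin (n G)} → Edge G x y →
                Injective _≡_ _≡_ φX → Injective _≡_ _≡_ φY →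
                (∀ i → Edge G y (φX i)) → (∀ i → Edge G x (φY i)) →
                (∀ i j → adj G (φY i) (φX j) ≡ false) → HasInducedS t G
  induced-Stt {t} {x} {y} {φX} {φY} xy φX-inj φY-inj yX xY YX = φ , φ-inj , φ-adj
    where
    φ : SV t → Fin (n G)
    φ vx      = x
    φ vy      = y
    φ (vxi i) = φX i
    φ (vyi i) = φY i

    φ-adj : ∀ a b → adj G (φ a) (φ b) ≡ sadj a b
    φ-adj vx      vx      = irrefl G x
    φ-adj vx      vy      = xy
    φ-adj vx      (vxi i) = common-neighbour⇒non-adjacent (Edge-sym G xy) (yX i)
    φ-adj vx      (vyi i) = xY i
    φ-adj vy      vx      = Edge-sym G xy
    φ-adj vy      vy      = irrefl G y
    φ-adj vy      (vxi i) = yX i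
    φ-adj vy      (vyi i) = common-neighbour⇒non-adjacent xy (xY i)
    φ-adj (vxi i) vx      = common-neighbour⇒non-adjacent (yX i) (Edge-sym G xy)
    φ-adj (vxi i) vy      = Edge-sym G (yX i)
    φ-adj (vxi i) (vxi j) = common-neighbour⇒non-adjacent (yX i) (yX j)
    φ-adj (vxi i) (vyi j) = trans (Graph.sym G (φX i) (φY j)) (YX j i)
    φ-adj (vyi i) vx      = Edge-sym G (xY i)
    φ-adj (vyi i) vy      = common-neighbour⇒non-adjacent (xY i) xy
    φ-adj (vyi i) (vxi j) = YX i j
    φ-adj (vyi i) (vyi j) = common-neighbour⇒non-adjacent (xY i) (xY j)

    -- Equal images have equal neighbourhoods in S_{t,t}, which tells apart all pairs of vertices
    -- except two x_i or two y_i.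
    same-row : ∀ a b → φ a ≡ φ b → ∀ c → sadj a c ≡ sadj b c
    same-row a b eq c = trans (sym (φ-adj a c)) (trans (cong (λ v → adj G v (φ c)) eq) (φ-adj b c))

    φ-inj : Injective _≡_ _≡_ φ
    φ-inj {vx}    {vx}    _  = refl
    φ-inj {vy}    {vy}    _  = refl
    φ-inj {vxi i} {vxi j} eq = cong vxi (φX-inj eq)
    φ-inj {vyi i} {vyi j} eq = cong vyi (φY-inj eq)
    φ-inj {vx}    {vy}    eq = contradiction (same-row vx vy eq vx) λ ()
    φ-inj {vx}    {vxi i} eq = contradiction (same-row vx (vxi i) eq (vyi i)) λ ()
    φ-inj {vx}    {vyi i} eq = contradiction (same-row vx (vyi i) eq vy) λ ()
    φ-inj {vy}    {vx}    eq = contradiction (same-row vy vx eq vx) λ ()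
    φ-inj {vy}    {vxi i} eq = contradiction (same-row vy (vxi i) eq vx) λ ()
    φ-inj {vy}    {vyi i} eq = contradiction (same-row vy (vyi i) eq (vxi i)) λ ()
    φ-inj {vxi i} {vx}    eq = contradiction (same-row (vxi i) vx eq (vyi i)) λ ()
    φ-inj {vxi i} {vy}    eq = contradiction (same-row (vxi i) vy eq vx) λ ()
    φ-inj {vxi i} {vyi j} eq = contradiction (same-row (vxi i) (vyi j) eq vx) λ ()
    φ-inj {vyi i} {vx}    eq = contradiction (same-row (vyi i) vx eq vy) λ ()
    φ-inj {vyi i} {vy}    eq = contradiction (same-row (vyi i) vy eq (vxi i)) λ ()
    φ-inj {vyi i} {vxi j} eq = contradiction (same-row (vyi i) (vxi j) eq vx) λ ()

-- The greedy lemma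

far-bound : ℕ → ℕ → ℕ
far-bound t p = t * (2 * p) ^ t

module Greedy (G : Graph) (p t : ℕ) .{{_ : NonZero p}} {U Z : Subset (n G)}
              (Z-large : 2 * p * t ≤ ∣ Z ∣) (U-sparse : ∀ {u} → u ∈ U → ∣ Z ∣ ≤ p * ∣ Z ─ N G u ∣) where

  record Stage (j : ℕ) : Set where
    field
      Y X          : Subset (n G)
      Y⊆U          : Y ⊆ U
      X⊆Z          : X ⊆ Z
      ∣X∣≡j        : ∣ X ∣ ≡ j
      anticomplete : Anticomplete G Y X
      ∣U∣≤         : ∣ U ∣ ≤ ∣ Y ∣ * (2 * p) ^ j

  initial : Stage 0
  initial = record
    { Y = U ; X = ⊥ ; Y⊆U = id ; X⊆Z = λ v∈⊥ → contradiction v∈⊥ ∉⊥ ; ∣X∣≡j = ∣⊥∣≡0 (n G)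
    ; anticomplete = λ _ v∈⊥ → contradiction v∈⊥ ∉⊥ ; ∣U∣≤ = ≤-reflexive (sym (*-identityʳ ∣ U ∣)) }

  extend : ∀ {j} → j < t → Stage j → Stage (suc j)
  extend {j} j<t s = record
    { Y = Y ─ N G z ; X = X ∪ ⁅ z ⁆
    ; Y⊆U = Y⊆U ∘ p─q⊆p Y (N G z)
    ; X⊆Z = X∪z⊆Z ; ∣X∣≡j = trans (x∉p⇒∣p∪⁅x⁆∣≡1+∣p∣ z∉X) (cong suc ∣X∣≡j)
    ; anticomplete = anticomplete′ ; ∣U∣≤ = ∣U∣≤′ }
    where
    open Stage s
    Z′ : Subset (n G)
    Z′ = Z ─ X

    ∣q∣≤j+∣q─X∣ : ∀ q → ∣ q ∣ ≤ j + ∣ q ─ X ∣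
    ∣q∣≤j+∣q─X∣ q = subst (λ k → ∣ q ∣ ≤ k + ∣ q ─ X ∣) ∣X∣≡j (∣p∣≤∣q∣+∣p─q∣ q X)

    Z′-nonempty : Nonempty Z′
    Z′-nonempty = 0<∣p∣⇒Nonempty Z′ (m<m+n⇒0<n j (begin-strict
      j            <⟨ j<t ⟩
      t            ≤⟨ m≤n*m t (2 * p) {{m*n≢0 2 p}} ⟩
      2 * p * t    ≤⟨ Z-large ⟩
      ∣ Z ∣        ≤⟨ ∣q∣≤j+∣q─X∣ Z ⟩
      j + ∣ Z′ ∣   ∎))
      where open ≤-Reasoning

    Y-sparse : ∀ {u} → u ∈ Y → ∣ Z′ ∣ ≤ 2 * p * ∣ Z′ ─ N G u ∣
    Y-sparse {u} u∈Y = begin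
      ∣ Z′ ∣                 ≤⟨ ∣p─q∣≤∣p∣ Z X ⟩
      ∣ Z ∣                  ≤⟨ x≤a+b⇒2a≤x⇒x≤2b (p * j) _ ∣Z∣≤pj+ 2pj≤∣Z∣ ⟩
      2 * (p * ∣ Z′ ─ N G u ∣) ≡⟨ *-assoc 2 p _ ⟨
      2 * p * ∣ Z′ ─ N G u ∣   ∎
      where
      open ≤-Reasoning
      ∣Z∣≤pj+ : ∣ Z ∣ ≤ p * j + p * ∣ Z′ ─ N G u ∣
      ∣Z∣≤pj+ = begin
        ∣ Z ∣                      ≤⟨ U-sparse (Y⊆U u∈Y) ⟩
        p * ∣ Z ─ N G u ∣          ≤⟨ *-monoʳ-≤ p (∣q∣≤j+∣q─X∣ (Z ─ N G u)) ⟩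
        p * (j + ∣ Z ─ N G u ─ X ∣) ≡⟨ cong (λ q → p * (j + ∣ q ∣)) (p─q─r≡p─r─q Z (N G u) X) ⟩
        p * (j + ∣ Z′ ─ N G u ∣)    ≡⟨ *-distribˡ-+ p j _ ⟩
        p * j + p * ∣ Z′ ─ N G u ∣  ∎
      2pj≤∣Z∣ : 2 * (p * j) ≤ ∣ Z ∣
      2pj≤∣Z∣ = begin
        2 * (p * j) ≡⟨ *-assoc 2 p j ⟨
        2 * p * j   ≤⟨ *-monoʳ-≤ (2 * p) (<⇒≤ j<t) ⟩
        2 * p * t   ≤⟨ Z-large ⟩
        ∣ Z ∣       ∎

    popular : ∃ λ z → z ∈ Z′ × ∣ Y ∣ ≤ 2 * p * ∣ Y ─ N G z ∣
    popular = popular-non-neighbour G (2 * p) Z′-nonempty Y-sparse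
    z : Fin (n G)
    z = proj₁ popular
    z∈Z′ : z ∈ Z′
    z∈Z′ = proj₁ (proj₂ popular)

    z∉X : z ∉ X
    z∉X = x∈p─q⇒x∉q z∈Z′

    X∪z⊆Z : X ∪ ⁅ z ⁆ ⊆ Z
    X∪z⊆Z {v} v∈ with x∈p∪q⁻ X ⁅ z ⁆ v∈
    ... | inj₁ v∈X  = X⊆Z v∈X
    ... | inj₂ v∈⁅z⁆ rewrite x∈⁅y⁆⇒x≡y z v∈⁅z⁆ = p─q⊆p Z X z∈Z′

    anticomplete′ : Anticomplete G (Y ─ N G z) (X ∪ ⁅ z ⁆)
    anticomplete′ {u} {v} u∈ v∈ with x∈p∪q⁻ X ⁅ z ⁆ v∈
    ... | inj₁ v∈X  = anticomplete (p─q⊆p Y (N G z) u∈) v∈X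
    ... | inj₂ v∈⁅z⁆ rewrite x∈⁅y⁆⇒x≡y z v∈⁅z⁆ =
      trans (Graph.sym G u z) (¬-not (x∈p─q⇒x∉q u∈ ∘ Edge⇒∈N G))

    ∣U∣≤′ : ∣ U ∣ ≤ ∣ Y ─ N G z ∣ * (2 * p) ^ suc j
    ∣U∣≤′ = begin
      ∣ U ∣                                  ≤⟨ ∣U∣≤ ⟩
      ∣ Y ∣ * (2 * p) ^ j                    ≤⟨ *-monoˡ-≤ ((2 * p) ^ j) (proj₂ (proj₂ popular)) ⟩
      2 * p * ∣ Y ─ N G z ∣ * (2 * p) ^ j    ≡⟨ cong (_* (2 * p) ^ j) (*-comm (2 * p) _) ⟩
      ∣ Y ─ N G z ∣ * (2 * p) * (2 * p) ^ j  ≡⟨ *-assoc ∣ Y ─ N G z ∣ (2 * p) _ ⟩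
      ∣ Y ─ N G z ∣ * (2 * p) ^ suc j        ∎
      where open ≤-Reasoning

  stage : ∀ j → j ≤ t → Stage j
  stage zero    _   = initial
  stage (suc j) j<t = extend j<t (stage j (<⇒≤ j<t))

  anticomplete-pair : far-bound t p ≤ ∣ U ∣ →
                      ∃ λ Y → ∃ λ X → Y ⊆ U × X ⊆ Z × t ≤ ∣ Y ∣ × t ≤ ∣ X ∣ × Anticomplete G Y X
  anticomplete-pair U-large = Y , X , Y⊆U , X⊆Z , t≤∣Y∣ , ≤-reflexive (sym ∣X∣≡j) , anticomplete
    where
    open Stage (stage t ≤-refl)
    t≤∣Y∣ : t ≤ ∣ Y ∣
    t≤∣Y∣ = *-cancelʳ-≤ t ∣ Y ∣ ((2 * p) ^ t) {{m^n≢0 (2 * p) t {{m*n≢0 2 p}}}} (≤-trans U-large ∣U∣≤)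

module _ (G : Graph) (bip : Bipartite G) {t : ℕ} (free : InducedSttFree t G) where

  few-far-vertices : ∀ p .{{_ : NonZero p}} {x y} (Z : Subset (n G)) → Edge G x y → Z ⊆ N G y → 2 * p * t ≤ ∣ Z ∣ →
                     ∣ far G p Z (N G x) ∣ < far-bound t p
  few-far-vertices p {x} Z xy Z⊆Ny Z-large =
    ≰⇒> (free ∘ induced ∘ Greedy.anticomplete-pair G p t Z-large (proj₂ ∘ ∈-far⁻ G p Z {N G x}))
    where
    induced : (∃ λ Y → ∃ λ X → Y ⊆ far G p Z (N G x) × X ⊆ Z × t ≤ ∣ Y ∣ × t ≤ ∣ X ∣ × Anticomplete G Y X) →
              HasInducedS t G
    induced (Y , X , Y⊆far , X⊆Z , t≤∣Y∣ , t≤∣X∣ , anti) with injection-into X t≤∣X∣ | injection-into Y t≤∣Y∣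
    ... | φX , φX-inj , φX∈X | φY , φY-inj , φY∈Y =
      induced-Stt G bip xy φX-inj φY-inj (λ i → ∈N⇒Edge G (Z⊆Ny (X⊆Z (φX∈X i))))
                  (λ i → ∈N⇒Edge G (proj₁ (∈-far⁻ G p Z {N G x} (Y⊆far (φY∈Y i)))))
                  (λ i j → anti (φY∈Y i) (φX∈X j))

-- The path x₁x₂x₃x₄

-- The term 8↧ε·t makes N(x₄) ∩ N(r), which holds at least half of N(x₄), large enough for the
-- last application of the greedy lemma (p = 2↧ε); the far-bound terms cover the neighbours of
-- x₃ excluded in choosing r and the final count |S| ≤ far-bound t 4 + 2 · far-bound t (2↧ε).
C₃ : ℕ → ℚ → ℕ
C₃ t ε = 8 * ↧ₙ ε * t + (far-bound t 4 + 2 * far-bound t (2 * ↧ₙ ε))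

module Path-argument (G : Graph) (bip : Bipartite G) {t : ℕ} (free : InducedSttFree t G)
                     {ε : ℚ} (0<ε : 0ℚ ℚ.< ε) (δ : MinDegree≥ G (C₃ t ε))
                     {x₁ x₂ x₃ x₄ : Fin (n G)}
                     (x₁x₂ : Edge G x₁ x₂) (x₂x₃ : Edge G x₂ x₃) (x₃x₄ : Edge G x₃ x₄) where

  D : ℕ
  D = ↧ₙ ε

  K : ℕ → ℕ
  K = far-bound t

  T Q Sε F S′ : Subset (n G)
  T = N G x₄
  Q = N G x₂
  Sε = S G (N G x₁) T ε
  F = far G 4 Q (N G x₁)
  S′ = Sε ─ F

  1≤D : 1 ≤ D
  1≤D = s≤s z≤n

  8Dt≤C₃ : 8 * D * t ≤ C₃ t ε
  8Dt≤C₃ = m≤m+n (8 * D * t) _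

  8Dt≤∣T∣ : 8 * D * t ≤ ∣ T ∣
  8Dt≤∣T∣ = ≤-trans 8Dt≤C₃ (δ x₄)

  8Dt≡2[2[2D]t] : 8 * D * t ≡ 2 * (2 * (2 * D) * t)
  8Dt≡2[2[2D]t] = eq D t
    where
    eq : ∀ D t → 8 * D * t ≡ 2 * (2 * (2 * D) * t)
    eq = solve-∀

  T-large : 2 * (2 * D) * t ≤ ∣ T ∣
  T-large = ≤-trans (m≤m+n _ _) (subst (_≤ ∣ T ∣) 8Dt≡2[2[2D]t] 8Dt≤∣T∣)

  Q-large : 2 * 4 * t ≤ ∣ Q ∣
  Q-large = ≤-trans (*-monoˡ-≤ t (*-monoʳ-≤ 8 1≤D)) (≤-trans 8Dt≤C₃ (δ x₂))

  few-far-neighbours : ∣ far G (2 * D) T (N G x₃) ∣ + ∣ far G 4 Q (N G x₃) ∣ < ∣ N G x₃ ∣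
  few-far-neighbours = begin-strict
    ∣ far G (2 * D) T (N G x₃) ∣ + ∣ far G 4 Q (N G x₃) ∣
      <⟨ +-mono-< (few-far-vertices G bip free (2 * D) T x₃x₄ id T-large)
                  (few-far-vertices G bip free 4 Q (Edge-sym G x₂x₃) id Q-large) ⟩
    K (2 * D) + K 4         ≡⟨ +-comm (K (2 * D)) (K 4) ⟩
    K 4 + K (2 * D)         ≤⟨ +-monoʳ-≤ (K 4) (m≤m+n (K (2 * D)) _) ⟩
    K 4 + 2 * K (2 * D)     ≤⟨ m≤n+m (K 4 + 2 * K (2 * D)) (8 * D * t) ⟩
    C₃ t ε                  ≤⟨ δ x₃ ⟩
    ∣ N G x₃ ∣              ∎
    where open ≤-Reasoning

  typical-neighbour : ∃ λ r → 2 * D * ∣ T ─ N G r ∣ < ∣ T ∣ × 4 * ∣ Q ─ N G r ∣ < ∣ Q ∣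
  typical-neighbour = r , ∉-far G (2 * D) T r∈N[x₃] r∉F₁ , ∉-far G 4 Q r∈N[x₃] r∉F₂
    where
    F₁ F₂ : Subset (n G)
    F₁ = far G (2 * D) T (N G x₃)
    F₂ = far G 4 Q (N G x₃)
    r-witness : Nonempty (N G x₃ ─ F₁ ─ F₂)
    r-witness = ∣q∣+∣r∣<∣p∣⇒Nonempty[p─q─r] (N G x₃) F₁ F₂ few-far-neighbours
    r : Fin (n G)
    r = proj₁ r-witness
    r∈N[x₃]─F₁ : r ∈ N G x₃ ─ F₁
    r∈N[x₃]─F₁ = p─q⊆p (N G x₃ ─ F₁) F₂ (proj₂ r-witness)
    r∈N[x₃] : r ∈ N G x₃
    r∈N[x₃] = p─q⊆p (N G x₃) F₁ r∈N[x₃]─F₁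
    r∉F₁ : r ∉ F₁
    r∉F₁ = x∈p─q⇒x∉q r∈N[x₃]─F₁
    r∉F₂ : r ∉ F₂
    r∉F₂ = x∈p─q⇒x∉q (proj₂ r-witness)

  r : Fin (n G)
  r = proj₁ typical-neighbour

  T-typical : 2 * D * ∣ T ─ N G r ∣ < ∣ T ∣
  T-typical = proj₁ (proj₂ typical-neighbour)

  Q-typical : 4 * ∣ Q ─ N G r ∣ < ∣ Q ∣
  Q-typical = proj₂ (proj₂ typical-neighbour)

  Sε⊆far : Sε ⊆ far G D T (N G x₁)
  Sε⊆far = S⊆far G 0<ε (N G x₁) T

  S′⊆N[x₁] : S′ ⊆ N G x₁
  S′⊆N[x₁] u∈S′ = proj₁ (∈-far⁻ G D T {N G x₁} (Sε⊆far (p─q⊆p Sε F u∈S′)))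

  S′-far-from-T : ∀ {u} → u ∈ S′ → ∣ T ∣ ≤ D * ∣ T ─ N G u ∣
  S′-far-from-T u∈S′ = proj₂ (∈-far⁻ G D T {N G x₁} (Sε⊆far (p─q⊆p Sε F u∈S′)))

  S′-close-to-Q : ∀ {u} → u ∈ S′ → 4 * ∣ Q ─ N G u ∣ < ∣ Q ∣
  S′-close-to-Q u∈S′ = ∉-far G 4 Q (S′⊆N[x₁] u∈S′) (x∈p─q⇒x∉q u∈S′)

  S′-dense : ∀ {u} → u ∈ S′ → ∣ Q ∩ N G r ∣ ≤ 2 * ∣ (Q ∩ N G r) ∩ N G u ∣
  S′-dense {u} u∈S′ = ∣p∩q∣≤2∣p∩q∩r∣ Q (N G r) (N G u) (<⇒≤ Q-typical) (<⇒≤ (S′-close-to-Q u∈S′))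

  common-neighbourhood-nonempty : Nonempty (Q ∩ N G r)
  common-neighbourhood-nonempty = ∣p─q∣<∣p∣⇒Nonempty[p∩q] Q (N G r) (≤-<-trans (m≤n*m ∣ Q ─ N G r ∣ 4) Q-typical)

  popular : ∃ λ w → w ∈ Q ∩ N G r × ∣ S′ ∣ ≤ 2 * ∣ S′ ∩ N G w ∣
  popular = popular-neighbour G 2 common-neighbourhood-nonempty S′-dense

  w : Fin (n G)
  w = proj₁ popular

  wr : Edge G w r
  wr = Edge-sym G (∈N⇒Edge G (proj₂ (x∈p∩q⁻ Q (N G r) (proj₁ (proj₂ popular)))))

  common-neighbourhood-large : 2 * (2 * D) * t ≤ ∣ T ∩ N G r ∣
  common-neighbourhood-large = *-cancelˡ-≤ 2 (begin
    2 * (2 * (2 * D) * t) ≡⟨ 8Dt≡2[2[2D]t] ⟨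
    8 * D * t             ≤⟨ 8Dt≤∣T∣ ⟩
    ∣ T ∣                 ≤⟨ ∣p∣≤2∣p∩q∣ T (N G r)
                               (≤-trans (*-monoˡ-≤ ∣ T ─ N G r ∣ (*-monoʳ-≤ 2 1≤D)) (<⇒≤ T-typical)) ⟩
    2 * ∣ T ∩ N G r ∣     ∎)
    where open ≤-Reasoning

  S′∩N⊆far : S′ ∩ N G w ⊆ far G (2 * D) (T ∩ N G r) (N G w)
  S′∩N⊆far {u} u∈ = ∈-far⁺ G (2 * D) (T ∩ N G r) (proj₂ (x∈p∩q⁻ S′ (N G w) u∈))
    (∣p∩q∣≤2k∣p∩q─r∣ D T (N G r) (N G u) (<⇒≤ T-typical) (S′-far-from-T (proj₁ (x∈p∩q⁻ S′ (N G w) u∈))))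

  ∣Sε∣≤C₃ : ∣ Sε ∣ ≤ C₃ t ε
  ∣Sε∣≤C₃ = begin
    ∣ Sε ∣                     ≤⟨ ∣p∣≤∣q∣+∣p─q∣ Sε F ⟩
    ∣ F ∣ + ∣ S′ ∣             ≤⟨ +-monoʳ-≤ ∣ F ∣ (proj₂ (proj₂ popular)) ⟩
    ∣ F ∣ + 2 * ∣ S′ ∩ N G w ∣ ≤⟨ +-mono-≤ (<⇒≤ few-F) (*-monoʳ-≤ 2 (<⇒≤ few-S′∩Nw)) ⟩
    K 4 + 2 * K (2 * D)        ≤⟨ m≤n+m (K 4 + 2 * K (2 * D)) (8 * D * t) ⟩
    C₃ t ε                     ∎
    where
    open ≤-Reasoning
    few-F : ∣ F ∣ < K 4
    few-F = few-far-vertices G bip free 4 Q x₁x₂ id Q-large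
    few-S′∩Nw : ∣ S′ ∩ N G w ∣ < K (2 * D)
    few-S′∩Nw = ≤-<-trans (p⊆q⇒∣p∣≤∣q∣ S′∩N⊆far)
      (few-far-vertices G bip free (2 * D) (T ∩ N G r) wr (p∩q⊆q T (N G r)) common-neighbourhood-large)

lemma1p10 : Σ (ℕ → ℚ → ℕ) λ C₃ →
    ∀ (t : ℕ) (ε : ℚ) → 0ℚ ℚ.< ε → ε ℚ.< 1ℚ →
    ∀ (G : Graph) → Bipartite G → MinDegree≥ G (C₃ t ε) → InducedSttFree t G →
    ∀ (x₁ x₂ x₃ x₄ : Fin (n G)) → Path4 G x₁ x₂ x₃ x₄ →
    ∣ S G (N G x₁) (N G x₄) ε ∣ ≤ C₃ t ε
lemma1p10 = C₃ , λ t ε 0<ε _ G bip δ free _ _ _ _ (x₁x₂ , x₂x₃ , x₃x₄ , _) →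
  Path-argument.∣Sε∣≤C₃ G bip free 0<ε δ x₁x₂ x₂x₃ x₃x₄
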